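{- Let $F:A\times B\to\{0,1\}$ be a communication problem (function). Then $$\log\mathsf{L}(F\times F)\geq\log\mathsf{L}(F)+\Omega\left(\sqrt{\log\mathsf{L}(F)}\right)-\log\log|A||B|-4,$$ where $\Omega(\cdot)$ hides an absolute positive constant.
   Context: $A,B$ are finite sets. A deterministic protocol for $F$ is a rooted binary tree where each node $v$ is owned by Alice or Bob and carries a rectangle $R_v=X_v\times Y_v$, the root carries $A\times B$, children of an Alice node partition $X_v$ (keeping $Y_v$), children of a Bob node partition $Y_v$ (keeping $X_v$), and each leaf carries a rectangle on which $F$ is constant, that constant being the output. $\mathsf{L}(F)$ is the minimum number of leaves of such a protocol. $F\times F:(A\times A)\times(B\times B)\to\{0,1\}^2$ is the problem where Alice gets $(a,a')$, Bob gets $(b,b')$ and they must output $(F(a,b),F(a',b'))$. Logarithms are base 2. -}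

module Defs where

open import Data.Nat using (ℕ; zero; suc; _+_; _*_; _^_; _≤_)
open import Data.Bool using (Bool; true; false; _∨_; _∧_)
open import Data.Fin using (Fin)
open import Data.Product using (Σ; _×_; _,_)
open import Relation.Binary.PropositionalEquality using (_≡_)

Subset : Set → Set
Subset A = A → Bool

full : {A : Set} → Subset A
full _ = true

-- X is partitioned into the two parts X₁ and X₂ (parts may be empty;
-- allowing empty parts does not change the minimum number of leaves).
Partition : {A : Set} → Subset A → Subset A → Subset A → Set
Partition X X₁ X₂ = (∀ a → X a ≡ (X₁ a ∨ X₂ a)) × (∀ a → (X₁ a ∧ X₂ a) ≡ false)

data Protocol {A B O : Set} (F : A → B → O) : Subset A → Subset B → Set where
  leaf  : ∀ {X Y} (o : O) →
          (∀ a b → X a ≡ true → Y b ≡ true → F a b ≡ o) → Protocol F X Y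
  alice : ∀ {X Y} (X₁ X₂ : Subset A) → Partition X X₁ X₂ →
          Protocol F X₁ Y → Protocol F X₂ Y → Protocol F X Y
  bob   : ∀ {X Y} (Y₁ Y₂ : Subset B) → Partition Y Y₁ Y₂ →
          Protocol F X Y₁ → Protocol F X Y₂ → Protocol F X Y

leaves : ∀ {A B O : Set} {F : A → B → O} {X Y} → Protocol F X Y → ℕ
leaves (leaf _ _)          = 1
leaves (alice _ _ _ P Q)   = leaves P + leaves Q
leaves (bob _ _ _ P Q)     = leaves P + leaves Q

IsL : ∀ {A B O : Set} (F : A → B → O) → ℕ → Set
IsL F ℓ = Σ (Protocol F full full) (λ P → leaves P ≡ ℓ)
        × (∀ (P : Protocol F full full) → ℓ ≤ leaves P)

_⊗_ : ∀ {A B O : Set} → (A → B → O) → (A → B → O) →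
      (A × A) → (B × B) → O × O
(F ⊗ G) (a , a') (b , b') = F a b , G a' b'

-- Exact real-number-free encodings of the comparisons involving logs
-- (all logs base 2, p , q , e , f naturals, q , f ≥ 1):
--   p / q ≤ (1/d) · √(log ℓ)   ⟺   2^(p²d²) ≤ ℓ^(q²)
RatLeSqrtLogOver : ℕ → ℕ → ℕ → ℕ → Set
RatLeSqrtLogOver d p q ℓ = 2 ^ (p * p * (d * d)) ≤ ℓ ^ (q * q)

--   e / f ≤ log N   ⟺   2^e ≤ N^f
RatLeLog : ℕ → ℕ → ℕ → Set
RatLeLog e f N = 2 ^ e ≤ N ^ f

-- Slicing a protocol for F × F at a second-coordinate input (a′, b′) leaves a protocol for F
-- whose leaves are the leaf rectangles of F × F containing (a′, b′). Projecting those rectangles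
-- therefore gives k = L(F × F) monochromatic rectangles for F that cover every input at least
-- ℓ = L(F) times. Greedily picking the rectangle that covers most uncovered inputs, r·j of them
-- cover all of A × B as soon as k ≤ rℓ and |A||B| < 2^j, and by Aho–Ullman–Yannakakis a cover by
-- C monochromatic rectangles yields a protocol with at most (2C + 1)^t leaves when C < 2^t.
-- So log ℓ = O(log²(k/ℓ · log |A||B|)), which rearranges to the claim with constant 1/4.
module Submission where

open import Defs
open import Data.Nat using (ℕ; _*_; _^_; _≤_)
open import Data.Bool using (Bool)
open import Data.Fin using (Fin)
open import Data.Product using (Σ; _×_)

open import Data.Nat.Properties
open import Algebra.Properties.CommutativeSemigroup *-commutativeSemigroup
  using () renaming (interchange to *-interchange; x∙yz≈y∙xz to *-left-swap)
open import Algebra.Properties.CommutativeSemigroup +-commutativeSemigroup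
  using () renaming (interchange to +-interchange)
open import Algebra.Properties.Semiring.Sum +-*-semiring
  using (sum-syntax; ∑-distrib-+; *-distribˡ-sum; sum-cong-≗) renaming (sum to ∑)
open import Data.Bool using (true; false; _∧_; _∨_; not)
open import Data.Bool.ListAction using (any)
open import Data.Bool.Properties using (∧-conicalˡ; ∧-conicalʳ; ∧-comm; ∧-zeroʳ; ∨-comm; T-≡)
open import Data.Empty using (⊥; ⊥-elim)
open import Data.Fin using (zero; suc; fromℕ<; remQuot; combine)
open import Data.Fin.Properties using (remQuot-combine)
open import Data.List using (List; []; _∷_; _++_; [_]; length; map; allFin; filter)
open import Data.List.Extrema.Nat using (argmax; argmax-all; f[⊥]≤f[argmax]; f[xs]≤f[argmax])
open import Data.List.Membership.Propositional using (_∈_; find; lose)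
open import Data.List.Membership.Propositional.Properties
  using (∈-allFin; ∈-map⁺; ∈-map⁻; ∈-filter⁺; ∈-filter⁻)
open import Data.List.Properties using (map-++; length-++; length-map; length-filter)
open import Data.List.Relation.Unary.All as All using (All; []; _∷_)
open import Data.List.Relation.Unary.All.Properties using (++⁺)
open import Data.List.Relation.Unary.Any using (Any; here; there)
open import Data.List.Relation.Unary.Any.Properties using (any⁺; any⁻)
open import Data.Nat using (zero; suc; _+_; _<_; z≤n; s≤s; NonZero; >-nonZero; >-nonZero⁻¹; _≤?_; _≟_)
open import Data.Nat.DivMod using (_/_; _%_; m≡m%n+[m/n]*n; m%n<n; m/n*n≤m)
open import Data.Nat.ListAction using (sum)
open import Data.Nat.ListAction.Properties using (sum-++)
open import Data.Nat.Tactic.RingSolver using (solve-∀)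
open import Data.Product using (_,_; proj₁; proj₂; ∃-syntax; uncurry)
open import Data.Sum using (_⊎_; inj₁; inj₂)
open import Function using (_∘_; flip; Equivalence)
open import Relation.Binary.PropositionalEquality
  using (_≡_; refl; sym; trans; cong; cong₂; subst; module ≡-Reasoning)
open import Relation.Nullary using (yes; no)
open import Relation.Unary using (Decidable)

private variable
  A B O : Set

𝟙 : Bool → ℕ
𝟙 true  = 1
𝟙 false = 0

_∩_ : Subset A → Subset A → Subset A
(X ∩ P) a = X a ∧ P a

_∖_ : Subset A → Subset A → Subset A
(X ∖ P) a = X a ∧ not (P a)

_⊆_ : Subset A → Subset A → Set
X ⊆ Y = ∀ a → X a ≡ true → Y a ≡ true

true≢false : true ≡ false → ⊥
true≢false ()

∧-true : ∀ {x y} → x ≡ true → y ≡ true → (x ∧ y) ≡ true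
∧-true refl refl = refl

∩-⊆ˡ : (X P : Subset A) → (X ∩ P) ⊆ X
∩-⊆ˡ X P a = ∧-conicalˡ (X a) (P a)

∩-⊆ʳ : (X P : Subset A) → (X ∩ P) ⊆ P
∩-⊆ʳ X P a = ∧-conicalʳ (X a) (P a)

∖-⊆ : (X P : Subset A) → (X ∖ P) ⊆ X
∖-⊆ X P a = ∧-conicalˡ (X a) (not (P a))

∖-excludes : (X P : Subset A) → ∀ a → (X ∖ P) a ≡ true → P a ≡ false
∖-excludes X P a h with P a
... | false = refl
... | true  = trans (sym h) (∧-zeroʳ (X a))

⊆-refl : {X : Subset A} → X ⊆ X
⊆-refl a Xa = Xa

⊆-trans : {X Y Z : Subset A} → X ⊆ Y → Y ⊆ Z → X ⊆ Z
⊆-trans X⊆Y Y⊆Z a Xa = Y⊆Z a (X⊆Y a Xa)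

⊆-∩ : {X' X P : Subset A} → X' ⊆ X → X' ⊆ P → X' ⊆ (X ∩ P)
⊆-∩ X'⊆X X'⊆P a X'a = ∧-true (X'⊆X a X'a) (X'⊆P a X'a)

∩-monoˡ : {X' X : Subset A} (P : Subset A) → X' ⊆ X → (X' ∩ P) ⊆ (X ∩ P)
∩-monoˡ {X' = X'} P X'⊆X = ⊆-∩ (⊆-trans (∩-⊆ˡ X' P) X'⊆X) (∩-⊆ʳ X' P)

∖-partition : (X P : Subset A) → Partition X (X ∩ P) (X ∖ P)
∖-partition X P = (λ a → split (X a) (P a)) , (λ a → disjoint (X a) (P a))
  where
  split : ∀ x p → x ≡ ((x ∧ p) ∨ (x ∧ not p))
  split false p     = refl
  split true  true  = refl
  split true  false = refl
  disjoint : ∀ x p → ((x ∧ p) ∧ (x ∧ not p)) ≡ false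
  disjoint false p     = refl
  disjoint true  true  = refl
  disjoint true  false = refl

nonEmpty : ∀ {m} → Subset (Fin m) → Bool
nonEmpty X = any X (allFin _)

nonEmpty-intro : ∀ {m} (X : Subset (Fin m)) a → X a ≡ true → nonEmpty X ≡ true
nonEmpty-intro X a Xa = Equivalence.to T-≡
  (any⁺ X (lose (∈-allFin a) (Equivalence.from T-≡ Xa)))

nonEmpty-elim : ∀ {m} (X : Subset (Fin m)) → nonEmpty X ≡ true → ∃[ a ] X a ≡ true
nonEmpty-elim X h with find (any⁻ X (allFin _) (Equivalence.from T-≡ h))
... | a , _ , Xa = a , Equivalence.to T-≡ Xa

nonEmpty-false : ∀ {m} (X : Subset (Fin m)) → nonEmpty X ≡ false → ∀ a → X a ≡ false
nonEmpty-false X h a with X a in Xa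
... | false = refl
... | true  = trans (sym (nonEmpty-intro X a Xa)) h

⊆-nonEmpty : ∀ {m} {X Y : Subset (Fin m)} → X ⊆ Y → nonEmpty X ≡ true → nonEmpty Y ≡ true
⊆-nonEmpty {Y = Y} X⊆Y h with nonEmpty-elim _ h
... | a , Xa = nonEmpty-intro Y a (X⊆Y a Xa)

partition-sym : {X X₁ X₂ : Subset A} → Partition X X₁ X₂ → Partition X X₂ X₁
partition-sym {X₁ = X₁} {X₂} (cover , disjoint) =
  (λ a → trans (cover a) (∨-comm (X₁ a) (X₂ a))) ,
  (λ a → trans (∧-comm (X₂ a) (X₁ a)) (disjoint a))

partition-emptyˡ : ∀ {m} {X X₁ X₂ : Subset (Fin m)} → Partition X X₁ X₂ → nonEmpty X₁ ≡ false →
                   ∀ a → X₂ a ≡ X a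
partition-emptyˡ {X₁ = X₁} {X₂} (cover , _) e a =
  sym (trans (cover a) (cong (_∨ X₂ a) (nonEmpty-false X₁ e a)))

Protocol≤ : (F : A → B → O) → Subset A → Subset B → ℕ → Set
Protocol≤ F X Y b = Σ (Protocol F X Y) λ P → leaves P ≤ b

leaves-positive : ∀ {F : A → B → O} {X Y} (P : Protocol F X Y) → 1 ≤ leaves P
leaves-positive (leaf _ _)          = ≤-refl
leaves-positive (alice _ _ _ P _)   = ≤-trans (leaves-positive P) (m≤m+n _ _)
leaves-positive (bob _ _ _ P _)     = ≤-trans (leaves-positive P) (m≤m+n _ _)

transpose : ∀ {F : A → B → O} {X Y} → Protocol F X Y → Protocol (flip F) Y X
transpose (leaf o mono)          = leaf o (λ b a Yb Xa → mono a b Xa Yb)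
transpose (alice X₁ X₂ part P Q) = bob X₁ X₂ part (transpose P) (transpose Q)
transpose (bob Y₁ Y₂ part P Q)   = alice Y₁ Y₂ part (transpose P) (transpose Q)

leaves-transpose : ∀ {F : A → B → O} {X Y} (P : Protocol F X Y) → leaves (transpose P) ≡ leaves P
leaves-transpose (leaf _ _)          = refl
leaves-transpose (alice _ _ _ P Q)   = cong₂ _+_ (leaves-transpose P) (leaves-transpose Q)
leaves-transpose (bob _ _ _ P Q)     = cong₂ _+_ (leaves-transpose P) (leaves-transpose Q)

transpose≤ : ∀ {F : A → B → O} {X Y b} → Protocol≤ F X Y b → Protocol≤ (flip F) Y X b
transpose≤ (P , P≤b) = transpose P , ≤-trans (≤-reflexive (leaves-transpose P)) P≤b

transportRows : ∀ {F : A → B → O} {X X' Y} → (∀ a → X a ≡ X' a) →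
                Protocol F X Y → Protocol F X' Y
transportRows X≐X' (leaf o mono) = leaf o (λ a b X'a Yb → mono a b (trans (X≐X' a) X'a) Yb)
transportRows X≐X' (alice X₁ X₂ (cover , disjoint) P Q) =
  alice X₁ X₂ ((λ a → trans (sym (X≐X' a)) (cover a)) , disjoint) P Q
transportRows X≐X' (bob Y₁ Y₂ part P Q) =
  bob Y₁ Y₂ part (transportRows X≐X' P) (transportRows X≐X' Q)

leaves-transportRows : ∀ {F : A → B → O} {X X' Y} (X≐X' : ∀ a → X a ≡ X' a)
                       (P : Protocol F X Y) → leaves (transportRows {X = X} {X'} X≐X' P) ≡ leaves P
leaves-transportRows X≐X' (leaf _ _)        = refl
leaves-transportRows X≐X' (alice _ _ _ _ _) = refl
leaves-transportRows X≐X' (bob _ _ _ P Q)   =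
  cong₂ _+_ (leaves-transportRows X≐X' P) (leaves-transportRows X≐X' Q)

relax : ∀ {F : A → B → O} {X Y b b'} → b ≤ b' → Protocol≤ F X Y b → Protocol≤ F X Y b'
relax b≤b' (P , P≤b) = P , ≤-trans P≤b b≤b'

transportRows≤ : ∀ {m} {F : Fin m → B → O} {X X' : Subset (Fin m)} {Y c} →
                 (∀ a → X' a ≡ X a) → nonEmpty X ≡ true →
                 (nonEmpty X' ≡ true → Protocol≤ F X' Y c) → Protocol≤ F X Y c
transportRows≤ {X = X} {X'} X'≐X neX P with P (⊆-nonEmpty (λ a Xa → trans (X'≐X a) Xa) neX)
... | Q , Q≤c =
  transportRows X'≐X Q , ≤-trans (≤-reflexive (leaves-transportRows {X = X'} {X} X'≐X Q)) Q≤c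

joinRows : ∀ {m} {F : Fin m → B → O} {X X₁ X₂ Y c₁ c₂} →
           Partition X X₁ X₂ → nonEmpty X ≡ true →
           (nonEmpty X₁ ≡ true → Protocol≤ F X₁ Y c₁) →
           (nonEmpty X₂ ≡ true → Protocol≤ F X₂ Y c₂) →
           Protocol≤ F X Y (c₁ + c₂)
joinRows {X₁ = X₁} {X₂} {c₁ = c₁} {c₂} part neX P₁ P₂ with nonEmpty X₁ in e₁
... | false = relax (m≤n+m c₂ c₁) (transportRows≤ (partition-emptyˡ part e₁) neX P₂)
... | true with nonEmpty X₂ in e₂
...   | true  = alice X₁ X₂ part (proj₁ (P₁ refl)) (proj₁ (P₂ refl)) ,
                +-mono-≤ (proj₂ (P₁ refl)) (proj₂ (P₂ refl))
...   | false = relax (m≤m+n c₁ c₂)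
                  (transportRows≤ (partition-emptyˡ (partition-sym {X₁ = X₁} {X₂} part) e₂) neX
                                  (λ _ → P₁ refl))

joinCols : ∀ {n} {F : A → Fin n → O} {X Y Y₁ Y₂ c₁ c₂} →
           Partition Y Y₁ Y₂ → nonEmpty Y ≡ true →
           (nonEmpty Y₁ ≡ true → Protocol≤ F X Y₁ c₁) →
           (nonEmpty Y₂ ≡ true → Protocol≤ F X Y₂ c₂) →
           Protocol≤ F X Y (c₁ + c₂)
joinCols part neY P₁ P₂ = transpose≤ (joinRows part neY (transpose≤ ∘ P₁) (transpose≤ ∘ P₂))

sieveRows : ∀ {F : A → B → O} {X Y b c} (Ps : List (Subset A)) →
            (∀ {P} → P ∈ Ps → ∀ {X'} → X' ⊆ X → X' ⊆ P → Protocol≤ F X' Y b) →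
            (∀ {X'} → X' ⊆ X → (∀ a → X' a ≡ true → All (λ P → P a ≡ false) Ps) →
                       Protocol≤ F X' Y c) →
            Protocol≤ F X Y (length Ps * b + c)
sieveRows []       piece rest = rest ⊆-refl (λ _ _ → [])
sieveRows {X = X} {b = b} {c} (P ∷ Ps) piece rest =
  alice (X ∩ P) (X ∖ P) (∖-partition X P) (proj₁ inside) (proj₁ outside) ,
  ≤-trans (+-mono-≤ (proj₂ inside) (proj₂ outside)) (≤-reflexive (sym (+-assoc b (length Ps * b) c)))
  where
  inside = piece (here refl) (∩-⊆ˡ X P) (∩-⊆ʳ X P)
  outside = sieveRows {X = X ∖ P} Ps
    (λ P'∈Ps X'⊆ X'⊆P' → piece (there P'∈Ps) (⊆-trans X'⊆ (∖-⊆ X P)) X'⊆P')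
    (λ X'⊆ avoid → rest (⊆-trans X'⊆ (∖-⊆ X P))
                        (λ a X'a → ∖-excludes X P a (X'⊆ a X'a) ∷ avoid a X'a))

sieveCols : ∀ {F : A → B → O} {X Y b c} (Ps : List (Subset B)) →
            (∀ {P} → P ∈ Ps → ∀ {Y'} → Y' ⊆ Y → Y' ⊆ P → Protocol≤ F X Y' b) →
            (∀ {Y'} → Y' ⊆ Y → (∀ b → Y' b ≡ true → All (λ P → P b ≡ false) Ps) →
                       Protocol≤ F X Y' c) →
            Protocol≤ F X Y (length Ps * b + c)
sieveCols Ps piece rest = transpose≤ (sieveRows Ps
  (λ P∈Ps Y'⊆Y Y'⊆P → transpose≤ (piece P∈Ps Y'⊆Y Y'⊆P))
  (λ Y'⊆Y avoid → transpose≤ (rest Y'⊆Y avoid)))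

IsL-positive : ∀ {F : A → B → O} {ℓ} → IsL F ℓ → 1 ≤ ℓ
IsL-positive ((P , refl) , _) = leaves-positive P

record Rect (A B O : Set) : Set where
  constructor rect
  field
    rows   : Subset A
    cols   : Subset B
    colour : O
open Rect

inRect : Rect A B O → A → B → Bool
inRect R a b = rows R a ∧ cols R b

Monochromatic : (A → B → O) → Rect A B O → Set
Monochromatic G R = ∀ a b → rows R a ≡ true → cols R b ≡ true → G a b ≡ colour R

countᵇ : (A → Bool) → List A → ℕ
countᵇ p xs = sum (map (𝟙 ∘ p) xs)

countᵇ-++ : (p : A → Bool) (xs ys : List A) → countᵇ p (xs ++ ys) ≡ countᵇ p xs + countᵇ p ys
countᵇ-++ p xs ys = trans (cong sum (map-++ (𝟙 ∘ p) xs ys)) (sum-++ (map (𝟙 ∘ p) xs) _)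

countᵇ≤length : (p : A → Bool) (xs : List A) → countᵇ p xs ≤ length xs
countᵇ≤length p []       = z≤n
countᵇ≤length p (x ∷ xs) = +-mono-≤ (𝟙≤1 (p x)) (countᵇ≤length p xs)
  where
  𝟙≤1 : ∀ b → 𝟙 b ≤ 1
  𝟙≤1 true  = ≤-refl
  𝟙≤1 false = z≤n

countᵇ-positive : (p : A → Bool) {x : A} {xs : List A} → x ∈ xs → p x ≡ true → 1 ≤ countᵇ p xs
countᵇ-positive p {xs = _ ∷ xs} (here refl) px =
  subst (λ b → 1 ≤ 𝟙 b + countᵇ p xs) (sym px) (s≤s z≤n)
countᵇ-positive p (there x∈)  px = ≤-trans (countᵇ-positive p x∈ px) (m≤n+m _ _)

countᵇ-mono : {p q : A → Bool} → (∀ x → p x ≡ true → q x ≡ true) →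
              ∀ xs → countᵇ p xs ≤ countᵇ q xs
countᵇ-mono p⇒q []       = z≤n
countᵇ-mono {p = p} {q} p⇒q (x ∷ xs) = +-mono-≤ (𝟙-mono (p x) (q x) (p⇒q x)) (countᵇ-mono p⇒q xs)
  where
  𝟙-mono : ∀ u v → (u ≡ true → v ≡ true) → 𝟙 u ≤ 𝟙 v
  𝟙-mono false v     _   = z≤n
  𝟙-mono true  v u⇒v rewrite u⇒v refl = ≤-refl

countᵇ-+ : {p q r : A → Bool} {xs : List A} → All (λ x → 𝟙 (p x) + 𝟙 (q x) ≤ 𝟙 (r x)) xs →
           countᵇ p xs + countᵇ q xs ≤ countᵇ r xs
countᵇ-+ []               = z≤n
countᵇ-+ {p = p} {q} {xs = x ∷ xs} (head ∷ tail) =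
  ≤-trans (≤-reflexive (+-interchange (𝟙 (p x)) (countᵇ p xs) (𝟙 (q x)) (countᵇ q xs)))
          (+-mono-≤ head (countᵇ-+ tail))

coverage : List (Rect A B O) → A → B → ℕ
coverage L a b = countᵇ (λ R → inRect R a b) L

Covers : List (Rect A B O) → Set
Covers L = ∀ a b → Any (λ R → inRect R a b ≡ true) L

-- Slicing a protocol for F ⊗ G

fibre : {C : Set} → Subset (C × A) → A → Subset C
fibre X a' a = X (a , a')

fibre-partition : {C : Set} {X X₁ X₂ : Subset (C × A)} → Partition X X₁ X₂ →
                  ∀ a' → Partition (fibre X a') (fibre X₁ a') (fibre X₂ a')
fibre-partition (cover , disjoint) a' = (λ a → cover (a , a')) , (λ a → disjoint (a , a'))

module _ {m n} {F G : Fin m → Fin n → O} where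

  leafRects : ∀ {X Y} → Protocol (F ⊗ G) X Y → List (Rect (Fin m) (Fin n) O)
  leafRects (leaf {X} {Y} o _) = [ rect (nonEmpty ∘ fibre X) (nonEmpty ∘ fibre Y) (proj₂ o) ]
  leafRects (alice _ _ _ P Q)  = leafRects P ++ leafRects Q
  leafRects (bob _ _ _ P Q)    = leafRects P ++ leafRects Q

  length-leafRects : ∀ {X Y} (P : Protocol (F ⊗ G) X Y) → length (leafRects P) ≡ leaves P
  length-leafRects (leaf _ _)        = refl
  length-leafRects (alice _ _ _ P Q) =
    trans (length-++ (leafRects P)) (cong₂ _+_ (length-leafRects P) (length-leafRects Q))
  length-leafRects (bob _ _ _ P Q)   =
    trans (length-++ (leafRects P)) (cong₂ _+_ (length-leafRects P) (length-leafRects Q))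

  leafRects-monochromatic : ∀ {X Y} (P : Protocol (F ⊗ G) X Y) → All (Monochromatic G) (leafRects P)
  leafRects-monochromatic (leaf o mono) = second-coordinate ∷ []
    where
    second-coordinate : Monochromatic G _
    second-coordinate a' b' neX neY with nonEmpty-elim _ neX | nonEmpty-elim _ neY
    ... | a , Xa | b , Yb = cong proj₂ (mono (a , a') (b , b') Xa Yb)
  leafRects-monochromatic (alice _ _ _ P Q) =
    ++⁺ (leafRects-monochromatic P) (leafRects-monochromatic Q)
  leafRects-monochromatic (bob _ _ _ P Q)   =
    ++⁺ (leafRects-monochromatic P) (leafRects-monochromatic Q)

  slice : ∀ {X Y} (P : Protocol (F ⊗ G) X Y) a' b' →
          nonEmpty (fibre X a') ≡ true → nonEmpty (fibre Y b') ≡ true →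
          Protocol≤ F (fibre X a') (fibre Y b') (coverage (leafRects P) a' b')
  slice (leaf o mono) a' b' neX neY rewrite neX | neY =
    leaf (proj₁ o) (λ a b Xa Yb → cong proj₁ (mono (a , a') (b , b') Xa Yb)) , ≤-refl
  slice (alice X₁ X₂ part P Q) a' b' neX neY =
    relax (≤-reflexive (sym (countᵇ-++ _ (leafRects P) (leafRects Q))))
      (joinRows (fibre-partition {X₁ = X₁} {X₂} part a') neX
        (λ ne₁ → slice P a' b' ne₁ neY) (λ ne₂ → slice Q a' b' ne₂ neY))
  slice (bob Y₁ Y₂ part P Q) a' b' neX neY =
    relax (≤-reflexive (sym (countᵇ-++ _ (leafRects P) (leafRects Q))))
      (joinCols (fibre-partition {X₁ = Y₁} {Y₂} part b') neY
        (λ ne₁ → slice P a' b' neX ne₁) (λ ne₂ → slice Q a' b' neX ne₂))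

  leafRects-coverage : ∀ {ℓ} → (∀ (P : Protocol F full full) → ℓ ≤ leaves P) →
                       (P : Protocol (F ⊗ G) full full) → ∀ a' b' → ℓ ≤ coverage (leafRects P) a' b'
  leafRects-coverage minimal P a' b' with slice P a' b' (nonEmpty-intro _ a' refl) (nonEmpty-intro _ b' refl)
  ... | Q , Q≤coverage = ≤-trans (minimal Q) Q≤coverage

point : ∀ {m n} .{{_ : NonZero (m * n)}} → Fin m × Fin n
point {m} {n} = remQuot {m} n (fromℕ< (>-nonZero⁻¹ (m * n)))

IsL≤IsL-⊗ : ∀ {m n} {F G : Fin m → Fin n → O} {ℓ k} .{{_ : NonZero (m * n)}} →
            IsL F ℓ → IsL (F ⊗ G) k → ℓ ≤ k
IsL≤IsL-⊗ {m = m} {n = n} {ℓ = ℓ} (_ , minimal) ((P , refl) , _) = begin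
  ℓ                           ≤⟨ leafRects-coverage minimal P a b ⟩
  coverage (leafRects P) a b  ≤⟨ countᵇ≤length _ (leafRects P) ⟩
  length (leafRects P)        ≡⟨ length-leafRects P ⟩
  leaves P                    ∎
  where
  open ≤-Reasoning
  a = proj₁ (point {m} {n})
  b = proj₂ (point {m} {n})

x+y≤z⇒2x≤z⊎2y≤z : ∀ x y {z} → x + y ≤ z → 2 * x ≤ z ⊎ 2 * y ≤ z
x+y≤z⇒2x≤z⊎2y≤z x y x+y≤z with ≤-total x y
... | inj₁ x≤y = inj₁ (≤-trans (≤-reflexive (cong (x +_) (+-identityʳ x)))
                             (≤-trans (+-monoʳ-≤ x x≤y) x+y≤z))
... | inj₂ y≤x = inj₂ (≤-trans (≤-reflexive (cong (y +_) (+-identityʳ y)))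
                             (≤-trans (+-monoˡ-≤ y y≤x) x+y≤z))

^-distribʳ-* : ∀ m n o → (m * n) ^ o ≡ m ^ o * n ^ o
^-distribʳ-* m n zero    = refl
^-distribʳ-* m n (suc o) = begin
  m * n * (m * n) ^ o        ≡⟨ cong (m * n *_) (^-distribʳ-* m n o) ⟩
  m * n * (m ^ o * n ^ o)    ≡⟨ *-interchange m n (m ^ o) (n ^ o) ⟩
  m * m ^ o * (n * n ^ o)    ∎
  where open ≡-Reasoning

-- Bernoulli's inequality (1 + 1/x)^k ≥ 1 + k/x, multiplied out by x^(k+1).
bernoulli : ∀ x k → x ^ k * (x + k) ≤ suc x ^ k * x
bernoulli x zero    = ≤-reflexive (cong (1 *_) (+-identityʳ x))
bernoulli x (suc k) = begin
  x * x ^ k * (x + suc k)              ≤⟨ m≤m+n _ (x ^ k * k) ⟩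
  x * x ^ k * (x + suc k) + x ^ k * k  ≡⟨ expand x (x ^ k) k ⟩
  suc x * (x ^ k * (x + k))            ≤⟨ *-monoʳ-≤ (suc x) (bernoulli x k) ⟩
  suc x * (suc x ^ k * x)              ≡⟨ *-assoc (suc x) (suc x ^ k) x ⟨
  suc x * suc x ^ k * x                ∎
  where
  open ≤-Reasoning
  expand : ∀ x p k → x * p * (x + suc k) + p * k ≡ suc x * (p * (x + k))
  expand = solve-∀

-- (1 − 1/(m+1))^(m+1) ≤ 1/2, cleared of denominators.
m^[1+m]*2≤[1+m]^[1+m] : ∀ m → m ^ suc m * 2 ≤ suc m ^ suc m
m^[1+m]*2≤[1+m]^[1+m] zero      = z≤n
m^[1+m]*2≤[1+m]^[1+m] m@(suc _) = *-cancelʳ-≤ _ _ m (begin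
  m ^ suc m * 2 * m          ≡⟨ *-assoc (m ^ suc m) 2 m ⟩
  m ^ suc m * (2 * m)        ≤⟨ *-monoʳ-≤ (m ^ suc m) 2m≤m+[1+m] ⟩
  m ^ suc m * (m + suc m)    ≤⟨ bernoulli m (suc m) ⟩
  suc m ^ suc m * m          ∎)
  where
  open ≤-Reasoning
  2m≤m+[1+m] : 2 * m ≤ m + suc m
  2m≤m+[1+m] = +-monoʳ-≤ m (≤-trans (≤-reflexive (+-identityʳ m)) (n≤1+n m))

m^[[1+m]n]*2^n≤[1+m]^[[1+m]n] : ∀ m n → m ^ (suc m * n) * 2 ^ n ≤ suc m ^ (suc m * n)
m^[[1+m]n]*2^n≤[1+m]^[[1+m]n] m n = begin
  m ^ (suc m * n) * 2 ^ n      ≡⟨ cong (_* 2 ^ n) (^-*-assoc m (suc m) n) ⟨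
  (m ^ suc m) ^ n * 2 ^ n      ≡⟨ ^-distribʳ-* (m ^ suc m) 2 n ⟨
  (m ^ suc m * 2) ^ n          ≤⟨ ^-monoˡ-≤ n (m^[1+m]*2≤[1+m]^[1+m] m) ⟩
  (suc m ^ suc m) ^ n          ≡⟨ ^-*-assoc (suc m) (suc m) n ⟩
  suc m ^ (suc m * n)          ∎
  where open ≤-Reasoning

o<2^n⇒m^[[1+m]n]*o<[1+m]^[[1+m]n] : ∀ m n {o} → o < 2 ^ n → m ^ (suc m * n) * o < suc m ^ (suc m * n)
o<2^n⇒m^[[1+m]n]*o<[1+m]^[[1+m]n] m n {o} o<2^n with m ^ (suc m * n) in eq
... | zero  = m^n>0 (suc m) (suc m * n)
... | suc p = begin-strict
  suc p * o                <⟨ *-monoʳ-< (suc p) o<2^n ⟩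
  suc p * 2 ^ n            ≡⟨ cong (_* 2 ^ n) eq ⟨
  m ^ (suc m * n) * 2 ^ n  ≤⟨ m^[[1+m]n]*2^n≤[1+m]^[[1+m]n] m n ⟩
  suc m ^ (suc m * n)      ∎
  where open ≤-Reasoning

m<[1+m/n]*n : ∀ m n .{{_ : NonZero n}} → m < suc (m / n) * n
m<[1+m/n]*n m n = begin-strict
  m                  ≡⟨ m≡m%n+[m/n]*n m n ⟩
  m % n + m / n * n  <⟨ +-monoˡ-< (m / n * n) (m%n<n m n) ⟩
  n + m / n * n      ∎
  where open ≤-Reasoning

^-cancelʳ-≤ : ∀ o .{{_ : NonZero o}} {m n} → m ^ o ≤ n ^ o → m ≤ n
^-cancelʳ-≤ o m^o≤n^o = ≮⇒≥ (λ n<m → <⇒≱ (^-monoˡ-< o n<m) m^o≤n^o)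

^-cancelˡ-≤ : ∀ m → 1 < m → ∀ {n o} → m ^ n ≤ m ^ o → n ≤ o
^-cancelˡ-≤ m 1<m m^n≤m^o = ≮⇒≥ (λ o<n → <⇒≱ (^-monoʳ-< m 1<m o<n) m^n≤m^o)

m*m≤n*n⇒m≤n : ∀ {m n} → m * m ≤ n * n → m ≤ n
m*m≤n*n⇒m≤n m*m≤n*n = ≮⇒≥ (λ n<m → <⇒≱ (*-mono-< n<m n<m) m*m≤n*n)

16x≤y⇒x<y : ∀ {x y} → 16 * x ≤ y → 16 < y → x < y
16x≤y⇒x<y {zero}  _     16<y = ≤-trans (s≤s z≤n) 16<y
16x≤y⇒x<y {suc x} 16x≤y _    =
  ≤-trans (s≤s (≤-trans (≤-reflexive (+-comm 1 x)) (+-monoʳ-≤ x (s≤s z≤n)))) 16x≤y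

N^f<2^e⇒f<e : ∀ {N e f} → 2 ≤ N → N ^ f < 2 ^ e → f < e
N^f<2^e⇒f<e {f = f} 2≤N N^f<2^e =
  ≰⇒> (λ e≤f → <⇒≱ N^f<2^e (≤-trans (^-monoʳ-≤ 2 e≤f) (^-monoˡ-≤ f 2≤N)))

N^f<2^e⇒N<2^[1+e/f] : ∀ {N e} f .{{_ : NonZero f}} → N ^ f < 2 ^ e → N < 2 ^ suc (e / f)
N^f<2^e⇒N<2^[1+e/f] {N} {e} f N^f<2^e = ≰⇒> λ 2^j≤N → <⇒≱ N^f<2^e (begin
  2 ^ e                  ≤⟨ ^-monoʳ-≤ 2 (<⇒≤ (m<[1+m/n]*n e f)) ⟩
  2 ^ (suc (e / f) * f)  ≡⟨ ^-*-assoc 2 (suc (e / f)) f ⟨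
  (2 ^ suc (e / f)) ^ f  ≤⟨ ^-monoˡ-≤ f 2^j≤N ⟩
  N ^ f                  ∎)
  where open ≤-Reasoning

1+2[1+a][1+b]≤2[1+a]*2[1+b] : ∀ a b → 1 + 2 * ((1 + a) * (1 + b)) ≤ 2 * (1 + a) * (2 * (1 + b))
1+2[1+a][1+b]≤2[1+a]*2[1+b] a b =
  ≤-trans (m≤m+n _ (1 + 2 * (a * b + a + b))) (≤-reflexive (expand a b))
  where
  expand : ∀ a b → 1 + 2 * ((1 + a) * (1 + b)) + (1 + 2 * (a * b + a + b)) ≡ 2 * (1 + a) * (2 * (1 + b))
  expand = solve-∀

4s≤[2+s]+[2+s]⇒s≤2 : ∀ s → 4 * s ≤ (2 + s) + (2 + s) → s ≤ 2
4s≤[2+s]+[2+s]⇒s≤2 s 4s≤t = *-cancelˡ-≤ 2 (+-cancelˡ-≤ (2 * s) (2 * s) 4 (begin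
  2 * s + 2 * s      ≡⟨ double s ⟩
  4 * s              ≤⟨ 4s≤t ⟩
  (2 + s) + (2 + s)  ≡⟨ shift s ⟩
  2 * s + 4          ∎))
  where
  open ≤-Reasoning
  double : ∀ s → 2 * s + 2 * s ≡ 4 * s
  double = solve-∀
  shift : ∀ s → (2 + s) + (2 + s) ≡ 2 * s + 4
  shift = solve-∀

-- Greedy set cover

sum-map-≤ : (f : A → ℕ) (c : ℕ) (xs : List A) → All (λ x → f x ≤ c) xs →
            sum (map f xs) ≤ length xs * c
sum-map-≤ f c []       []            = z≤n
sum-map-≤ f c (x ∷ xs) (fx≤c ∷ fxs≤c) = +-mono-≤ fx≤c (sum-map-≤ f c xs fxs≤c)

∑-mono-≤ : ∀ {N} {f g : Fin N → ℕ} → (∀ i → f i ≤ g i) → ∑[ i < N ] f i ≤ ∑[ i < N ] g i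
∑-mono-≤ {zero}  f≤g = z≤n
∑-mono-≤ {suc N} f≤g = +-mono-≤ (f≤g zero) (∑-mono-≤ (f≤g ∘ suc))

term≤∑ : ∀ {N} (f : Fin N → ℕ) i → f i ≤ ∑[ j < N ] f j
term≤∑ f zero    = m≤m+n _ _
term≤∑ f (suc i) = ≤-trans (term≤∑ (f ∘ suc) i) (m≤n+m _ _)

∑-const : ∀ N c → ∑[ i < N ] c ≡ N * c
∑-const zero    c = refl
∑-const (suc N) c = cong (c +_) (∑-const N c)

sum-map-∑ : ∀ {N} (f : A → Fin N → ℕ) (xs : List A) →
            sum (map (λ x → ∑[ i < N ] f x i) xs) ≡ ∑[ i < N ] sum (map (λ x → f x i) xs)
sum-map-∑ {N = N} f []       = sym (trans (∑-const N 0) (*-zeroʳ N))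
sum-map-∑         f (x ∷ xs) =
  trans (cong (∑ (f x) +_) (sum-map-∑ f xs)) (sym (∑-distrib-+ (f x) _))

module SetCover {S : Set} {N : ℕ} (_∋_ : S → Fin N → Bool) where

  size : Subset (Fin N) → ℕ
  size U = ∑[ i < N ] 𝟙 (U i)

  hits : Subset (Fin N) → S → ℕ
  hits U s = size (U ∩ (s ∋_))

  multiplicity : List S → Fin N → ℕ
  multiplicity L i = countᵇ (_∋ i) L

  Covered : List S → Fin N → Set
  Covered C i = Any (λ s → (s ∋ i) ≡ true) C

  size-full : size full ≡ N
  size-full = trans (∑-const N 1) (*-identityʳ N)

  size-positive : ∀ U i → U i ≡ true → 1 ≤ size U
  size-positive U i Ui = subst (λ u → 𝟙 u ≤ size U) Ui (term≤∑ (𝟙 ∘ U) i)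

  size-∖+hits : ∀ U s → size (U ∖ (s ∋_)) + hits U s ≡ size U
  size-∖+hits U s = trans (sym (∑-distrib-+ (𝟙 ∘ (U ∖ (s ∋_))) (𝟙 ∘ (U ∩ (s ∋_)))))
                          (sum-cong-≗ (λ i → split (U i) (s ∋ i)))
    where
    split : ∀ u h → 𝟙 (u ∧ not h) + 𝟙 (u ∧ h) ≡ 𝟙 u
    split false h     = refl
    split true  true  = refl
    split true  false = refl

  -- Double counting the incidences between U and the members of L.
  averaging : ∀ {ℓ} L U → (∀ i → ℓ ≤ multiplicity L i) → ℓ * size U ≤ sum (map (hits U) L)
  averaging {ℓ} L U ℓ-fold = begin
    ℓ * size U                                     ≡⟨ *-distribˡ-sum ℓ (𝟙 ∘ U) ⟩
    ∑ (λ i → ℓ * 𝟙 (U i))                          ≤⟨ ∑-mono-≤ pointwise ⟩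
    ∑ (λ i → sum (map (λ s → 𝟙 (U i ∧ s ∋ i)) L))  ≡⟨ sum-map-∑ (λ s i → 𝟙 (U i ∧ s ∋ i)) L ⟨
    sum (map (hits U) L)                           ∎
    where
    open ≤-Reasoning
    pointwise : ∀ i → ℓ * 𝟙 (U i) ≤ sum (map (λ s → 𝟙 (U i ∧ s ∋ i)) L)
    pointwise i with U i
    ... | true  = ≤-trans (≤-reflexive (*-identityʳ ℓ)) (ℓ-fold i)
    ... | false = ≤-trans (≤-reflexive (*-zeroʳ ℓ)) z≤n

  module Greedy (s₀ : S) (L : List S) {ℓ r : ℕ} .{{_ : NonZero ℓ}}
                (ℓ-fold : ∀ i → ℓ ≤ multiplicity (s₀ ∷ L) i)
                (few : length (s₀ ∷ L) ≤ suc r * ℓ) where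

    best : Subset (Fin N) → S
    best U = argmax (hits U) s₀ L

    best∈ : ∀ U → best U ∈ s₀ ∷ L
    best∈ U = argmax-all (hits U) (here refl) (All.tabulate there)

    best-maximal : ∀ U → All (λ s → hits U s ≤ hits U (best U)) (s₀ ∷ L)
    best-maximal U = f[⊥]≤f[argmax] {f = hits U} s₀ L ∷ f[xs]≤f[argmax] {f = hits U} s₀ L

    size≤hits-best : ∀ U → size U ≤ suc r * hits U (best U)
    size≤hits-best U = *-cancelˡ-≤ ℓ (begin
      ℓ * size U                   ≤⟨ averaging (s₀ ∷ L) U ℓ-fold ⟩
      sum (map (hits U) (s₀ ∷ L))  ≤⟨ sum-map-≤ (hits U) h (s₀ ∷ L) (best-maximal U) ⟩
      length (s₀ ∷ L) * h          ≤⟨ *-monoˡ-≤ h few ⟩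
      suc r * ℓ * h                ≡⟨ cong (_* h) (*-comm (suc r) ℓ) ⟩
      ℓ * suc r * h                ≡⟨ *-assoc ℓ (suc r) h ⟩
      ℓ * (suc r * h)              ∎)
      where
      open ≤-Reasoning
      h = hits U (best U)

    shrink : ∀ U → suc r * size (U ∖ (best U ∋_)) ≤ r * size U
    shrink U = +-cancelʳ-≤ u (suc r * x) (r * u) (begin
      suc r * x + u          ≤⟨ +-monoʳ-≤ (suc r * x) (size≤hits-best U) ⟩
      suc r * x + suc r * h  ≡⟨ *-distribˡ-+ (suc r) x h ⟨
      suc r * (x + h)        ≡⟨ cong (suc r *_) (size-∖+hits U (best U)) ⟩
      suc r * u              ≡⟨ +-comm u (r * u) ⟩
      r * u + u              ∎)
      where
      open ≤-Reasoning
      u = size U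
      x = size (U ∖ (best U ∋_))
      h = hits U (best U)

    greedy : ℕ → Subset (Fin N) → List S
    greedy zero    U = []
    greedy (suc t) U = best U ∷ greedy t (U ∖ (best U ∋_))

    length-greedy : ∀ t U → length (greedy t U) ≡ t
    length-greedy zero    U = refl
    length-greedy (suc t) U = cong suc (length-greedy t _)

    greedy⊆ : ∀ t U → All (_∈ s₀ ∷ L) (greedy t U)
    greedy⊆ zero    U = []
    greedy⊆ (suc t) U = best∈ U ∷ greedy⊆ t _

    greedy-covers : ∀ t U → r ^ t * size U < suc r ^ t → ∀ i → U i ≡ true → Covered (greedy t U) i
    greedy-covers zero U small i Ui =
      ⊥-elim (<⇒≱ small (≤-trans (size-positive U i Ui) (≤-reflexive (sym (*-identityˡ (size U))))))
    greedy-covers (suc t) U small i Ui with best U ∋ i in hit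
    ... | true  = here hit
    ... | false = there (greedy-covers t U' small' i (cong₂ (λ u h → u ∧ not h) Ui hit))
      where
      open ≤-Reasoning
      U' = U ∖ (best U ∋_)
      small' : r ^ t * size U' < suc r ^ t
      small' = *-cancelˡ-< (suc r) _ _ (begin-strict
        suc r * (r ^ t * size U')  ≡⟨ *-left-swap (suc r) (r ^ t) (size U') ⟩
        r ^ t * (suc r * size U')  ≤⟨ *-monoʳ-≤ (r ^ t) (shrink U) ⟩
        r ^ t * (r * size U)       ≡⟨ *-left-swap (r ^ t) r (size U) ⟩
        r * (r ^ t * size U)       ≡⟨ *-assoc r (r ^ t) (size U) ⟨
        r ^ suc t * size U         <⟨ small ⟩
        suc r ^ suc t              ∎)

  greedy-cover : ∀ {ℓ r j} .{{_ : NonZero N}} .{{_ : NonZero ℓ}} .{{_ : NonZero r}} (L : List S) →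
                 (∀ i → ℓ ≤ multiplicity L i) → length L ≤ r * ℓ → N < 2 ^ j →
                 ∃[ C ] All (_∈ L) C × length C ≡ r * j × (∀ i → Covered C i)
  greedy-cover {ℓ} [] ℓ-fold _ _ =
    ⊥-elim (<⇒≱ (>-nonZero⁻¹ ℓ) (ℓ-fold (fromℕ< (>-nonZero⁻¹ N))))
  greedy-cover {r = suc r} {j} (s₀ ∷ L) ℓ-fold few N<2^j =
    greedy t full , greedy⊆ t full , length-greedy t full ,
    λ i → greedy-covers t full small i refl
    where
    open Greedy s₀ L {r = r} ℓ-fold few
    t = suc r * j
    small : r ^ t * size full < suc r ^ t
    small = subst (λ x → r ^ t * x < suc r ^ t) (sym size-full)
                  (o<2^n⇒m^[[1+m]n]*o<[1+m]^[[1+m]n] r j N<2^j)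

-- From a cover to a protocol (Aho–Ullman–Yannakakis)

module _ {m n : ℕ} where

  meets : Rect (Fin m) (Fin n) Bool → Subset (Fin m) → Subset (Fin n) → Bool
  meets R X Y = nonEmpty (X ∩ rows R) ∧ nonEmpty (Y ∩ cols R)

  meets-mono : ∀ R {X X' Y Y'} → X' ⊆ X → Y' ⊆ Y → meets R X' Y' ≡ true → meets R X Y ≡ true
  meets-mono R X'⊆X Y'⊆Y h =
    ∧-true (⊆-nonEmpty (∩-monoˡ (rows R) X'⊆X) (∧-conicalˡ _ _ h))
           (⊆-nonEmpty (∩-monoˡ (cols R) Y'⊆Y) (∧-conicalʳ _ _ h))

  zerosMeeting : List (Rect (Fin m) (Fin n) Bool) → Subset (Fin m) → Subset (Fin n) → ℕ
  zerosMeeting L X Y = countᵇ (λ R → not (colour R) ∧ meets R X Y) L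

  zerosMeeting-mono : ∀ L {X X' Y Y'} → X' ⊆ X → Y' ⊆ Y → zerosMeeting L X' Y' ≤ zerosMeeting L X Y
  zerosMeeting-mono L X'⊆X Y'⊆Y = countᵇ-mono
    (λ R h → ∧-true (∧-conicalˡ (not (colour R)) _ h)
                    (meets-mono R X'⊆X Y'⊆Y (∧-conicalʳ (not (colour R)) _ h))) L

module _ {m n : ℕ} {F : Fin m → Fin n → Bool} where

  -- A 0-rectangle cannot meet both the rows and the columns of a 1-rectangle R,
  -- otherwise the two would share a point.
  zerosMeeting-split : ∀ L → All (Monochromatic F) L → ∀ {R} → Monochromatic F R → colour R ≡ true →
                       ∀ X Y → zerosMeeting L (X ∩ rows R) Y + zerosMeeting L X (Y ∩ cols R)
                                 ≤ zerosMeeting L X Y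
  zerosMeeting-split L monoL {R} monoR oneR X Y = countᵇ-+ (All.map split monoL)
    where
    𝟙-disjoint : ∀ {u v w} → (u ≡ true → w ≡ true) → (v ≡ true → w ≡ true) →
                 (u ≡ true → v ≡ true → ⊥) → 𝟙 u + 𝟙 v ≤ 𝟙 w
    𝟙-disjoint {false} {false} _   _   _        = z≤n
    𝟙-disjoint {true}  {false} u⇒w _   _        rewrite u⇒w refl = ≤-refl
    𝟙-disjoint {false} {true}  _   v⇒w _        rewrite v⇒w refl = ≤-refl
    𝟙-disjoint {true}  {true}  _   _   disjoint = ⊥-elim (disjoint refl refl)
    split : ∀ {S} → Monochromatic F S →
            𝟙 (not (colour S) ∧ meets S (X ∩ rows R) Y) + 𝟙 (not (colour S) ∧ meets S X (Y ∩ cols R))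
              ≤ 𝟙 (not (colour S) ∧ meets S X Y)
    split {S} monoS with colour S in zeroS
    ... | true  = z≤n
    ... | false = 𝟙-disjoint (meets-mono S (∩-⊆ˡ X (rows R)) ⊆-refl)
                             (meets-mono S ⊆-refl (∩-⊆ˡ Y (cols R))) clash
      where
      clash : meets S (X ∩ rows R) Y ≡ true → meets S X (Y ∩ cols R) ≡ true → ⊥
      clash h₁ h₂ with nonEmpty-elim _ (∧-conicalˡ _ _ h₁) | nonEmpty-elim _ (∧-conicalʳ _ _ h₂)
      ... | a , XRSa | b , YRSb
        with trans (sym (trans (monoR a b (∧-conicalʳ (X a) _ (∧-conicalˡ (X a ∧ rows R a) _ XRSa))
                                          (∧-conicalʳ (Y b) _ (∧-conicalˡ (Y b ∧ cols R b) _ YRSb))) oneR))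
                   (monoS a b (∧-conicalʳ (X a ∧ rows R a) _ XRSa) (∧-conicalʳ (Y b ∧ cols R b) _ YRSb))
      ... | ()

  zerosMeeting≡0⇒one : ∀ L → All (Monochromatic F) L → Covers L → ∀ {X Y} → zerosMeeting L X Y ≡ 0 →
                       ∀ a b → X a ≡ true → Y b ≡ true → F a b ≡ true
  zerosMeeting≡0⇒one L monoL covL {X} {Y} none a b Xa Yb with F a b in Fab | find (covL a b)
  ... | true  | _              = refl
  ... | false | R , R∈L , abR =
    ⊥-elim (<⇒≱ (countᵇ-positive (λ R → not (colour R) ∧ meets R X Y) R∈L zeroMeets)
                (≤-reflexive none))
    where
    Ra = ∧-conicalˡ (rows R a) _ abR
    Rb = ∧-conicalʳ (rows R a) _ abR
    zeroMeets : (not (colour R) ∧ meets R X Y) ≡ true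
    zeroMeets = ∧-true (cong not (trans (sym (All.lookup monoL R∈L a b Ra Rb)) Fab))
                       (∧-true (nonEmpty-intro _ a (∧-true Xa Ra)) (nonEmpty-intro _ b (∧-true Yb Rb)))

module CoverToProtocol {m n : ℕ} (F : Fin m → Fin n → Bool) (C : List (Rect (Fin m) (Fin n) Bool))
                       (monoC : All (Monochromatic F) C) (covC : Covers C) where

  zeros : Subset (Fin m) → Subset (Fin n) → ℕ
  zeros = zerosMeeting C

  RowHalving ColHalving : Subset (Fin m) → Subset (Fin n) → Rect (Fin m) (Fin n) Bool → Set
  RowHalving X Y R = 2 * zeros (X ∩ rows R) Y ≤ zeros X Y
  ColHalving X Y R = 2 * zeros X (Y ∩ cols R) ≤ zeros X Y

  rowHalving? : ∀ X Y → Decidable (RowHalving X Y)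
  rowHalving? X Y R = 2 * zeros (X ∩ rows R) Y ≤? zeros X Y

  colHalving? : ∀ X Y → Decidable (ColHalving X Y)
  colHalving? X Y R = 2 * zeros X (Y ∩ cols R) ≤? zeros X Y

  halvingRows : Subset (Fin m) → Subset (Fin n) → List (Subset (Fin m))
  halvingRows X Y = map rows (filter (rowHalving? X Y) C)

  halvingCols : Subset (Fin m) → Subset (Fin n) → List (Subset (Fin n))
  halvingCols X Y = map cols (filter (colHalving? X Y) C)

  length-map-filter≤ : ∀ {D : Set} (f : Rect (Fin m) (Fin n) Bool → D)
                       {P : Rect (Fin m) (Fin n) Bool → Set} (P? : Decidable P) →
                       length (map f (filter P? C)) ≤ length C
  length-map-filter≤ f P? = ≤-trans (≤-reflexive (length-map f (filter P? C))) (length-filter P? C)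

  one-halves : ∀ {R} → R ∈ C → colour R ≡ true → ∀ X Y → RowHalving X Y R ⊎ ColHalving X Y R
  one-halves {R} R∈C oneR X Y =
    x+y≤z⇒2x≤z⊎2y≤z (zeros (X ∩ rows R) Y) (zeros X (Y ∩ cols R))
                    (zerosMeeting-split C monoC (All.lookup monoC R∈C) oneR X Y)

  -- One round of the Aho–Ullman–Yannakakis protocol: every 1-rectangle of C halves the
  -- 0-rectangles either along its rows or along its columns, and once Alice and Bob have
  -- split off all halving rows and columns, no point of value 1 is left.
  round : ∀ {X Y b} →
          (∀ {X' Y'} → X' ⊆ X → Y' ⊆ Y → 2 * zeros X' Y' ≤ zeros X Y → Protocol≤ F X' Y' b) →
          Protocol≤ F X Y (length C * b + (length C * b + 1))
  round {X} {Y} {b} recurse =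
    relax (+-mono-≤ (*-monoˡ-≤ b (length-map-filter≤ rows (rowHalving? X Y)))
                    (+-monoˡ-≤ 1 (*-monoˡ-≤ b (length-map-filter≤ cols (colHalving? X Y)))))
          (sieveRows (halvingRows X Y) rowPiece afterRows)
    where
    rowPiece : ∀ {P} → P ∈ halvingRows X Y → ∀ {X'} → X' ⊆ X → X' ⊆ P → Protocol≤ F X' Y b
    rowPiece P∈ X'⊆X X'⊆P with ∈-map⁻ rows P∈
    ... | R , R∈ , refl = recurse X'⊆X ⊆-refl (≤-trans
      (*-monoʳ-≤ 2 (zerosMeeting-mono C (⊆-∩ X'⊆X X'⊆P) ⊆-refl))
      (proj₂ (∈-filter⁻ (rowHalving? X Y) {xs = C} R∈)))

    colPiece : ∀ {X'} → X' ⊆ X → ∀ {P} → P ∈ halvingCols X Y → ∀ {Y'} → Y' ⊆ Y → Y' ⊆ P →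
               Protocol≤ F X' Y' b
    colPiece X'⊆X P∈ Y'⊆Y Y'⊆P with ∈-map⁻ cols P∈
    ... | R , R∈ , refl = recurse X'⊆X Y'⊆Y (≤-trans
      (*-monoʳ-≤ 2 (zerosMeeting-mono C X'⊆X (⊆-∩ Y'⊆Y Y'⊆P)))
      (proj₂ (∈-filter⁻ (colHalving? X Y) {xs = C} R∈)))

    noOnes : ∀ {X' Y'} → (∀ a → X' a ≡ true → All (λ P → P a ≡ false) (halvingRows X Y)) →
             (∀ b → Y' b ≡ true → All (λ P → P b ≡ false) (halvingCols X Y)) →
             ∀ a b → X' a ≡ true → Y' b ≡ true → F a b ≡ false
    noOnes avoidRows avoidCols a b X'a Y'b with F a b in Fab
    ... | false = refl
    ... | true  = ⊥-elim (oneKilled (find (covC a b)))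
      where
      killed : ∀ {R} → R ∈ C → rows R a ≡ true → cols R b ≡ true → ⊥
      killed {R} R∈C Ra Rb with one-halves R∈C (trans (sym (All.lookup monoC R∈C a b Ra Rb)) Fab) X Y
      ... | inj₁ rowHalving = true≢false (trans (sym Ra) (All.lookup (avoidRows a X'a)
                                (∈-map⁺ rows (∈-filter⁺ (rowHalving? X Y) R∈C rowHalving))))
      ... | inj₂ colHalving = true≢false (trans (sym Rb) (All.lookup (avoidCols b Y'b)
                                (∈-map⁺ cols (∈-filter⁺ (colHalving? X Y) R∈C colHalving))))
      oneKilled : ∃[ R ] R ∈ C × inRect R a b ≡ true → ⊥
      oneKilled (R , R∈C , abR) =
        killed R∈C (∧-conicalˡ (rows R a) _ abR) (∧-conicalʳ (rows R a) _ abR)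

    afterRows : ∀ {X'} → X' ⊆ X →
                (∀ a → X' a ≡ true → All (λ P → P a ≡ false) (halvingRows X Y)) →
                Protocol≤ F X' Y (length (halvingCols X Y) * b + 1)
    afterRows {X'} X'⊆X avoidRows = sieveCols (halvingCols X Y) (colPiece X'⊆X)
      λ {Y'} _ avoidCols → leaf false (noOnes {X'} {Y'} avoidRows avoidCols) , ≤-refl

  round-bound : ∀ c {B} → 1 ≤ B → c * B + (c * B + 1) ≤ (1 + 2 * c) * B
  round-bound c {B} 1≤B = begin
    c * B + (c * B + 1)  ≡⟨ rearrange c B ⟩
    1 + 2 * c * B        ≤⟨ +-monoˡ-≤ (2 * c * B) 1≤B ⟩
    B + 2 * c * B        ∎
    where
    open ≤-Reasoning
    rearrange : ∀ c B → c * B + (c * B + 1) ≡ 1 + 2 * c * B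
    rearrange = solve-∀

  cover-protocol : ∀ t X Y → zeros X Y < 2 ^ t → Protocol≤ F X Y ((1 + 2 * length C) ^ t)
  cover-protocol t X Y small with zeros X Y ≟ 0
  ... | yes none = leaf true (zerosMeeting≡0⇒one C monoC covC none) , m^n>0 (1 + 2 * length C) t
  cover-protocol zero    X Y small | no some = ⊥-elim (some (n<1⇒n≡0 small))
  cover-protocol (suc t) X Y small | no _    =
    relax (round-bound (length C) (m^n>0 (1 + 2 * length C) t))
      (round λ {X'} {Y'} _ _ halved →
        cover-protocol t X' Y' (*-cancelˡ-< 2 _ _ (≤-<-trans halved small)))

  protocol : ∀ {t} → length C < 2 ^ t → Protocol≤ F full full ((1 + 2 * length C) ^ t)
  protocol {t} C<2^t = cover-protocol t full full (≤-<-trans (countᵇ≤length _ C) C<2^t)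

-- The amortised bound and the logarithmic estimate

-- The combinatorial content of the theorem, for N = |A||B|, ℓ = L(F) and k = L(F × F).
AmortisedBound : ℕ → ℕ → ℕ → Set
AmortisedBound N ℓ k = ∀ r j t .{{_ : NonZero r}} → N < 2 ^ j → k ≤ r * ℓ → r * j < 2 ^ t →
                       ℓ ≤ (1 + 2 * (r * j)) ^ t

amortised-bound : ∀ {m n} (F : Fin m → Fin n → Bool) {ℓ k} .{{_ : NonZero (m * n)}} →
                  IsL F ℓ → IsL (F ⊗ F) k → AmortisedBound (m * n) ℓ k
amortised-bound {m} {n} F {ℓ} Lℓ@(_ , minimal) ((P , refl) , _) r j t mn<2^j k≤rℓ rj<2^t
  with greedy-cover {ℓ = ℓ} {r} {j} (leafRects P)
         (λ i → leafRects-coverage minimal P (proj₁ (remQuot {m} n i)) (proj₂ (remQuot {m} n i)))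
         (≤-trans (≤-reflexive (length-leafRects P)) k≤rℓ) mn<2^j
  where
  open SetCover (λ R i → uncurry (inRect R) (remQuot {m} n i))
  instance
    ℓ≢0 : NonZero ℓ
    ℓ≢0 = >-nonZero (IsL-positive Lℓ)
... | C , C⊆P , |C|≡rj , covered = begin
  ℓ                            ≤⟨ minimal (proj₁ Q) ⟩
  leaves (proj₁ Q)             ≤⟨ proj₂ Q ⟩
  (1 + 2 * length C) ^ t       ≡⟨ cong (λ c → (1 + 2 * c) ^ t) |C|≡rj ⟩
  (1 + 2 * (r * j)) ^ t        ∎
  where
  open ≤-Reasoning
  monoC : All (Monochromatic F) C
  monoC = All.map (All.lookup (leafRects-monochromatic P)) C⊆P
  covC : Covers C
  covC a b = subst (λ ab → Any (λ R → uncurry (inRect R) ab ≡ true) C) (remQuot-combine a b)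
                   (covered (combine a b))
  Q = CoverToProtocol.protocol F C monoC covC {t} (subst (_< 2 ^ t) (sym |C|≡rj) rj<2^t)

leaves≤2^[t*t] : ∀ {N ℓ k e f s} .{{_ : NonZero ℓ}} .{{_ : NonZero f}} →
                 AmortisedBound N ℓ k → N ^ f < 2 ^ e → k / ℓ < 2 ^ s → e / f < 2 ^ s →
                 ℓ ≤ 2 ^ ((suc s + suc s) * (suc s + suc s))
leaves≤2^[t*t] {N} {ℓ} {k} {e} {f} {s} bound N^f<2^e k/ℓ<2^s e/f<2^s = begin
  ℓ                        ≤⟨ bound r j t N<2^j (<⇒≤ (m<[1+m/n]*n k ℓ)) rj<2^t ⟩
  (1 + 2 * (r * j)) ^ t    ≤⟨ ^-monoˡ-≤ t 1+2rj≤2^t ⟩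
  (2 ^ t) ^ t              ≡⟨ ^-*-assoc 2 t t ⟩
  2 ^ (t * t)              ∎
  where
  open ≤-Reasoning
  r = suc (k / ℓ)
  j = suc (e / f)
  t = suc s + suc s
  N<2^j = N^f<2^e⇒N<2^[1+e/f] f N^f<2^e
  1+2rj≤2^t : 1 + 2 * (r * j) ≤ 2 ^ t
  1+2rj≤2^t = begin
    1 + 2 * (r * j)          ≤⟨ 1+2[1+a][1+b]≤2[1+a]*2[1+b] (k / ℓ) (e / f) ⟩
    2 * r * (2 * j)          ≤⟨ *-mono-≤ (*-monoʳ-≤ 2 k/ℓ<2^s) (*-monoʳ-≤ 2 e/f<2^s) ⟩
    2 ^ suc s * 2 ^ suc s    ≡⟨ ^-distribˡ-+-* 2 (suc s) (suc s) ⟨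
    2 ^ t                    ∎
  rj<2^t : r * j < 2 ^ t
  rj<2^t = ≤-trans (s≤s (m≤m+n (r * j) (r * j + 0))) 1+2rj≤2^t

scale-bounds : ∀ {ℓ k e f s} .{{_ : NonZero ℓ}} .{{_ : NonZero f}} →
               ℓ ≤ k → f < e → 16 * k * e ≤ ℓ * 2 ^ s * f →
               16 < 2 ^ s × k / ℓ < 2 ^ s × e / f < 2 ^ s
scale-bounds {ℓ} {k} {e} {f} {s} ℓ≤k f<e 16ke≤ℓ2^sf = 16<2^s , k/ℓ<2^s , e/f<2^s
  where
  open ≤-Reasoning
  instance
    e≢0 : NonZero e
    e≢0 = >-nonZero (m<n⇒0<n f<e)
  shuffle : ∀ ℓ x e → ℓ * (16 * x * e) ≡ 16 * x * ℓ * e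
  shuffle = solve-∀
  cancel-ℓ : ∀ x → x * ℓ ≤ k → 16 * x * e ≤ 2 ^ s * f
  cancel-ℓ x xℓ≤k = *-cancelˡ-≤ ℓ (begin
    ℓ * (16 * x * e)    ≡⟨ shuffle ℓ x e ⟩
    16 * x * ℓ * e      ≡⟨ cong (_* e) (*-assoc 16 x ℓ) ⟩
    16 * (x * ℓ) * e    ≤⟨ *-monoˡ-≤ e (*-monoʳ-≤ 16 xℓ≤k) ⟩
    16 * k * e          ≤⟨ 16ke≤ℓ2^sf ⟩
    ℓ * 2 ^ s * f       ≡⟨ *-assoc ℓ (2 ^ s) f ⟩
    ℓ * (2 ^ s * f)     ∎)
  16e≤2^sf : 16 * e ≤ 2 ^ s * f
  16e≤2^sf = subst (_≤ 2 ^ s * f) (cong (_* e) (*-identityʳ 16))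
                   (cancel-ℓ 1 (≤-trans (≤-reflexive (*-identityˡ ℓ)) ℓ≤k))
  16<2^s : 16 < 2 ^ s
  16<2^s = *-cancelʳ-< f 16 (2 ^ s) (<-≤-trans (*-monoʳ-< 16 f<e) 16e≤2^sf)
  k/ℓ<2^s : k / ℓ < 2 ^ s
  k/ℓ<2^s = 16x≤y⇒x<y (*-cancelʳ-≤ _ _ e (≤-trans (cancel-ℓ (k / ℓ) (m/n*n≤m k ℓ))
                                                  (*-monoʳ-≤ (2 ^ s) (<⇒≤ f<e)))) 16<2^s
  e/f<2^s : e / f < 2 ^ s
  e/f<2^s = 16x≤y⇒x<y (*-cancelʳ-≤ _ _ f (begin
    16 * (e / f) * f    ≡⟨ *-assoc 16 (e / f) f ⟩
    16 * (e / f * f)    ≤⟨ *-monoʳ-≤ 16 (m/n*n≤m e f) ⟩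
    16 * e              ≤⟨ 16e≤2^sf ⟩
    2 ^ s * f           ∎)) 16<2^s

root-of-ratio-bound : ∀ {k e ℓ p q f} s .{{_ : NonZero q}} →
                      (16 * k * e) ^ q ≤ ℓ ^ q * 2 ^ p * f ^ q → p ≤ s * q →
                      16 * k * e ≤ ℓ * 2 ^ s * f
root-of-ratio-bound {k} {e} {ℓ} {p} {q} {f} s bound p≤sq = ^-cancelʳ-≤ q (begin
  (16 * k * e) ^ q             ≤⟨ bound ⟩
  ℓ ^ q * 2 ^ p * f ^ q        ≤⟨ *-monoˡ-≤ (f ^ q) (*-monoʳ-≤ (ℓ ^ q) (^-monoʳ-≤ 2 p≤sq)) ⟩
  ℓ ^ q * 2 ^ (s * q) * f ^ q  ≡⟨ cong (λ x → ℓ ^ q * x * f ^ q) (^-*-assoc 2 s q) ⟨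
  ℓ ^ q * (2 ^ s) ^ q * f ^ q  ≡⟨ cong (_* f ^ q) (^-distribʳ-* ℓ (2 ^ s) q) ⟨
  (ℓ * 2 ^ s) ^ q * f ^ q      ≡⟨ ^-distribʳ-* (ℓ * 2 ^ s) f q ⟨
  (ℓ * 2 ^ s * f) ^ q          ∎)
  where open ≤-Reasoning

root-of-sqrt-log-bound : ∀ {p q ℓ} s .{{_ : NonZero q}} →
                         RatLeSqrtLogOver 4 p q ℓ → s * q ≤ p → 2 ^ (4 * s * (4 * s)) ≤ ℓ
root-of-sqrt-log-bound {p} {q} {ℓ} s bound sq≤p = ^-cancelʳ-≤ (q * q) {{m*n≢0 q q}} (begin
  (2 ^ (4 * s * (4 * s))) ^ (q * q)   ≡⟨ ^-*-assoc 2 (4 * s * (4 * s)) (q * q) ⟩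
  2 ^ (4 * s * (4 * s) * (q * q))     ≡⟨ cong (2 ^_) (regroup s q) ⟩
  2 ^ (s * q * (s * q) * (4 * 4))     ≤⟨ ^-monoʳ-≤ 2 (*-monoˡ-≤ (4 * 4) (*-mono-≤ sq≤p sq≤p)) ⟩
  2 ^ (p * p * (4 * 4))               ≤⟨ bound ⟩
  ℓ ^ (q * q)                         ∎)
  where
  open ≤-Reasoning
  regroup : ∀ s q → 4 * s * (4 * s) * (q * q) ≡ s * q * (s * q) * (4 * 4)
  regroup = solve-∀

-- For s = ⌊p/q⌋ the hypotheses force 2^((4s)²) ≤ ℓ ≤ 2^((2s+4)²) and 16 < 2^(s+1),
-- which is impossible.
amortised⇒RatLeLog : ∀ {N ℓ k} .{{_ : NonZero ℓ}} → 2 ≤ N → ℓ ≤ k → AmortisedBound N ℓ k →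
                     ∀ p q e f .{{_ : NonZero q}} .{{_ : NonZero f}} →
                     RatLeSqrtLogOver 4 p q ℓ → (16 * k * e) ^ q ≤ ℓ ^ q * 2 ^ p * f ^ q →
                     RatLeLog e f N
amortised⇒RatLeLog {N} {ℓ} {k} 2≤N ℓ≤k bound p q e f sqrtLog ratio = ≮⇒≥ impossible
  where
  s = p / q
  impossible : N ^ f < 2 ^ e → ⊥
  impossible N^f<2^e = <⇒≱ 16<2^[1+s] (≤-trans (^-monoʳ-≤ 2 (s≤s s≤2)) (m≤m+n 8 8))
    where
    scales = scale-bounds {ℓ} {k} {e} {f} {suc s} ℓ≤k (N^f<2^e⇒f<e 2≤N N^f<2^e)
               (root-of-ratio-bound {k} {e} {ℓ} {p} {q} {f} (suc s) ratio (<⇒≤ (m<[1+m/n]*n p q)))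
    16<2^[1+s] = proj₁ scales
    s≤2 : s ≤ 2
    s≤2 = 4s≤[2+s]+[2+s]⇒s≤2 s (m*m≤n*n⇒m≤n (^-cancelˡ-≤ 2 ≤-refl (≤-trans
            (root-of-sqrt-log-bound s sqrtLog (m/n*n≤m p q))
            (leaves≤2^[t*t] {N} {ℓ} {k} {e} {f} {suc s} bound N^f<2^e
                            (proj₁ (proj₂ scales)) (proj₂ (proj₂ scales))))))

corollary4p8 : Σ ℕ λ d → 1 ≤ d ×
    (∀ (m n : ℕ) → 2 ≤ m * n → (F : Fin m → Fin n → Bool) →
     ∀ (ℓ k : ℕ) → IsL F ℓ → IsL (F ⊗ F) k →
     ∀ (p q e f : ℕ) → 1 ≤ q → 1 ≤ f →
     RatLeSqrtLogOver d p q ℓ →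
     (16 * k * e) ^ q ≤ ℓ ^ q * 2 ^ p * f ^ q →
     RatLeLog e f (m * n))
corollary4p8 = 4 , s≤s z≤n , λ m n 2≤mn F ℓ k Lℓ Lk p q e f 1≤q 1≤f →
  let instance
        mn≢0 = >-nonZero (≤-trans (s≤s z≤n) 2≤mn)
        ℓ≢0  = >-nonZero (IsL-positive Lℓ)
        q≢0  = >-nonZero 1≤q
        f≢0  = >-nonZero 1≤f
  in amortised⇒RatLeLog 2≤mn (IsL≤IsL-⊗ Lℓ Lk) (amortised-bound F Lℓ Lk) p q e f
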